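{- Let $m\ge1$, $n\ge1$, and let $P,Q$ be two $m$-Dyck paths of size $mn$. Let $(P';p_1,\dots,p_m)$ and $(Q';q_1,\dots,q_m)$ be the $m$-reductions of $P$ and $Q$. Then $P\le Q$ in $\mathcal{T}_n^{(m)}$ if and only if $P'\le Q'$ in $\mathcal{T}_{n-1}^{(m)}$ and, for each $i\in\{1,\dots,m\}$, the point $q_i$ lies to the right of $p_i$. Moreover, the non-initial contacts of $P$ correspond bijectively to the contacts of $P'$ lying to the right of $p_m$.
   Context: A Dyck path of size $N$ is a path of $N$ up steps $(1,1)$ and $N$ down steps $(1,-1)$ from $(0,0)$ to $(2N,0)$ never going below the $x$-axis. An $m$-Dyck path of size $mn$ is a Dyck path of size $mn$ in which, for each $i\in\{0,\dots,n-1\}$, the up steps of ranks $mi+1,\dots,m(i+1)$ are consecutive. For an up step $u$, its excursion is the shortest factor starting with $u$ that is a translated Dyck path, and the final step of that excursion is matched with $u$. The Tamari lattice $\mathcal{T}_N$ is the set of Dyck paths of size $N$ ordered by the reflexive-transitive closure of the covering relation: $Q$ covers $P$ if there is in $P$ a down step $d$ immediately followed by an up step $u$ such that $Q$ is obtained from $P$ by swapping $d$ and the excursion of $u$. $\mathcal{T}_n^{(m)}$ is the set of $m$-Dyck paths of size $mn$ with the order induced from $\mathcal{T}_{mn}$. A contact of a Dyck path is a vertex on the $x$-axis; the initial contact is $(0,0)$. A vertex $q$ lies to the right of a vertex $p$ if the abscissa of $q$ is at least that of $p$. The $m$-reduction of an $m$-Dyck path $P$ of positive size: let $u_1,\dots,u_m$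 be the initial $m$ up steps of $P$ and $d_1,\dots,d_m$ the down steps matched with them; $P'$ is obtained from $P$ by contracting the steps $u_1,\dots,u_m,d_1,\dots,d_m$, and $p_1,\dots,p_m$ are the vertices of $P'$ resulting from the contraction of $d_1,\dots,d_m$ respectively (these are contacts of $P'$, with $p_{i+1}$ to the right of $p_i$). -}

module Defs where

open import Data.Nat using (ℕ; zero; suc; _+_; _*_; _≤_; _<_)
open import Data.List using (List; []; _∷_; _++_; length; take; concat; replicate; concatMap)
open import Data.List.Relation.Unary.All using (All)
open import Data.Fin using (Fin; toℕ; fromℕ)
open import Data.Product using (Σ; _×_; ∃)
open import Relation.Binary.PropositionalEquality using (_≡_)
open import Relation.Binary.Construct.Closure.ReflexiveTransitive using (Star)

-- Steps: U = up step (1,1), D = down step (1,-1).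
data Step : Set where
  U D : Step

Word : Set
Word = List Step

ups : Word → ℕ
ups [] = 0
ups (U ∷ w) = suc (ups w)
ups (D ∷ w) = ups w

downs : Word → ℕ
downs [] = 0
downs (U ∷ w) = downs w
downs (D ∷ w) = suc (downs w)

IsDyck : Word → Set
IsDyck w = (∀ k → downs (take k w) ≤ ups (take k w)) × ups w ≡ downs w

IsDyckOfSize : ℕ → Word → Set
IsDyckOfSize N w = IsDyck w × ups w ≡ N

-- m-Dyck paths: the up steps come in consecutive groups of m
-- (ranks m i + 1 , … , m (i + 1)); i.e. the path is a sequence of
-- tokens, each either a block of m consecutive up steps or a down step.
data Token : Set where
  block down : Token

expand : ℕ → List Token → Word
expand m [] = []
expand m (block ∷ ts) = replicate m U ++ expand m ts
expand m (down ∷ ts) = D ∷ expand m ts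

IsMDyck : ℕ → ℕ → Word → Set
IsMDyck m n P = IsDyckOfSize (m * n) P × ∃ λ ts → P ≡ expand m ts

-- Tamari covering: P = A d (u X d') B  and  Q = A (u X d') d B, where
-- u X d' (X a Dyck word) is the excursion of the up step u following d.
Cover : Word → Word → Set
Cover P Q = Σ Word λ A → Σ Word λ X → Σ Word λ B →
  IsDyck X ×
  P ≡ A ++ D ∷ (U ∷ X ++ D ∷ []) ++ B ×
  Q ≡ A ++ (U ∷ X ++ D ∷ []) ++ D ∷ B

-- Tamari order (reflexive-transitive closure of the covering relation);
-- the order of T_n^(m) is the one induced from T_(mn), i.e. the same relation.
_≤T_ : Word → Word → Set
P ≤T Q = Star Cover P Q

glue : List Word → Word
glue [] = []
glue (Y ∷ []) = Y
glue (Y ∷ Z ∷ Ys) = Y ++ D ∷ glue (Z ∷ Ys)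

-- m-reduction of P: P = U^m Y₁ d Y₂ d … Yₘ d Yₘ₊₁ with all Yⱼ Dyck words
-- (the displayed down steps are exactly those matched with the initial
-- m up steps); P' = Y₁ Y₂ … Yₘ₊₁ and p i (i = 1..m, 0-indexed as Fin m)
-- is the abscissa in P' of the vertex resulting from contraction of the
-- i-th displayed down step, so p (i+1) lies to the right of p i.
IsMReduction : (m : ℕ) → Word → Word → (Fin m → ℕ) → Set
IsMReduction m P P' p = Σ (List Word) λ Ys →
  length Ys ≡ suc m ×
  All IsDyck Ys ×
  P ≡ replicate m U ++ glue Ys ×
  P' ≡ concat Ys ×
  (∀ (i : Fin m) → p i ≡ length (concat (take (suc (toℕ i)) Ys)))

-- A contact: a vertex (given by its abscissa k) on the x-axis.
IsContact : Word → ℕ → Set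
IsContact P k = k ≤ length P × ups (take k P) ≡ downs (take k P)

NonInitialContact : Word → Set
NonInitialContact P = Σ ℕ λ k → IsContact P k × 0 < k

ContactRightOf : Word → ℕ → Set
ContactRightOf P a = Σ ℕ λ k → IsContact P k × a ≤ k

lastIdx : ∀ m → 1 ≤ m → Fin m
lastIdx (suc k) _ = fromℕ k

-- Write P = Uᵐ Y₁ D Y₂ D … D Yₘ₊₁ with Dyck factors Yⱼ, so that P′ = Y₁ Y₂ … Yₘ₊₁ and pᵢ is the
-- abscissa where Yᵢ ends in P′. A Tamari cover of P never touches the initial Uᵐ, and the factor
-- U X D D it creates either lies inside one Yⱼ (then P′ is covered and no pᵢ moves) or is the first
-- arch of Yⱼ₊₁ moved across the separating D (then P′ is unchanged and pⱼ moves right). Hence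
-- P ≤ Q gives P′ ≤ Q′ and pᵢ ≤ qᵢ. Conversely, the swapped factor of a cover of a concatenation of
-- Dyck words never straddles a contact, so a chain P′ ≤ Q′ lifts factor by factor to a chain that
-- ends at Q and starts from P′ cut at the positions qᵢ; P reaches that start by pushing its
-- separators from pᵢ to qᵢ, since a down step followed by a Dyck word E lies below E followed by
-- the down step. Finally, the non-initial contacts of P are those after its first arch Uᵐ … D,
-- i.e. the contacts of Yₘ₊₁, and so are the contacts of P′ to the right of pₘ.

module Submission where

open import Defs
open import Data.Nat using (ℕ; zero; suc; _+_; _∸_; _≤_; _<_; z≤n; s≤s; _<?_; _≤?_)
open import Data.Nat.Properties
open import Data.Nat.Tactic.RingSolver using (solve-∀)
open import Algebra.Properties.CommutativeSemigroup +-commutativeSemigroup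
  using (xy∙z≈xz∙y; xy∙z≈x∙zy; x∙yz≈yx∙z)
open import Data.Fin using (Fin; toℕ; fromℕ; fromℕ<)
open import Data.Fin.Properties using (toℕ-fromℕ; toℕ-fromℕ<)
open import Data.List using (List; []; _∷_; _++_; _∷ʳ_; length; take; concat; replicate; map; initLast; _∷ʳ′_)
open import Data.List.Properties
  using ( ++-assoc; ++-identityʳ; ++-cancelˡ; ++-cancelʳ; length-++; length-++-≤ˡ; length-++-≤ʳ
        ; length-++-sucʳ; length-map; ∷-injective; ∷-injectiveʳ; concat-++)
open import Data.List.Relation.Unary.All as All using (All; []; _∷_)
open import Data.List.Relation.Unary.All.Properties using (∷ʳ⁻)
open import Data.Product using (Σ; ∃; ∃₂; _×_; _,_; proj₁)
open import Data.Sum using (_⊎_; inj₁; inj₂)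
open import Data.Empty using (⊥; ⊥-elim)
open import Relation.Nullary using (¬_; yes; no; Irrelevant)
open import Relation.Binary.PropositionalEquality
open import Relation.Binary.Construct.Closure.ReflexiveTransitive using (ε; _◅_; _◅◅_; gmap; fold)
open import Relation.Binary.Construct.Closure.ReflexiveTransitive.Properties
  using (module StarReasoning) renaming (reflexive to Star-reflexive)
open import Function.Bundles using (Equivalence; _⇔_; _↔_; _⤖_; mk⇔; mk↔ₛ′)
open import Function.Properties.Inverse using (↔⇒⤖)
open import Function.Construct.Composition using (_↔-∘_)
open import Function.Construct.Symmetry using (↔-sym)
open import Function.Base using (_∘_)

-- Walks and Dyck words

Walk : ℕ → Word → ℕ → Set
Walk h [] e = h ≡ e
Walk h (U ∷ w) e = Walk (suc h) w e
Walk zero (D ∷ w) e = ⊥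
Walk (suc h) (D ∷ w) e = Walk h w e

Dyck : Word → Set
Dyck w = Walk 0 w 0

walk-++ : ∀ {h k e} xs {ys} → Walk h xs k → Walk k ys e → Walk h (xs ++ ys) e
walk-++ [] refl q = q
walk-++ (U ∷ xs) p q = walk-++ xs p q
walk-++ {suc h} (D ∷ xs) p q = walk-++ xs p q

walk-++⁻ : ∀ {h e} xs {ys} → Walk h (xs ++ ys) e → ∃ λ k → Walk h xs k × Walk k ys e
walk-++⁻ {h} [] p = h , refl , p
walk-++⁻ (U ∷ xs) p = walk-++⁻ xs p
walk-++⁻ {suc h} (D ∷ xs) p = walk-++⁻ xs p

walk-balance : ∀ {h e} w → Walk h w e → h + ups w ≡ e + downs w
walk-balance {h} [] p = cong (_+ 0) p
walk-balance {h} (U ∷ w) p = trans (+-suc h _) (walk-balance w p)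
walk-balance {suc h} {e} (D ∷ w) p = trans (cong suc (walk-balance w p)) (sym (+-suc e _))

walk-displacement : ∀ {h e h′ e′} w → Walk h w e → Walk h′ w e′ → h + e′ ≡ h′ + e
walk-displacement {h} {e} {h′} {e′} w p q = +-cancelʳ-≡ (ups w) _ _ (begin
  h + e′ + ups w      ≡⟨ xy∙z≈xz∙y h e′ _ ⟩
  h + ups w + e′      ≡⟨ cong (_+ e′) (walk-balance w p) ⟩
  e + downs w + e′    ≡⟨ xy∙z≈x∙zy e _ e′ ⟩
  e + (e′ + downs w)  ≡⟨ cong (e +_) (walk-balance w q) ⟨
  e + (h′ + ups w)    ≡⟨ x∙yz≈yx∙z e h′ _ ⟩
  h′ + e + ups w      ∎)
  where open ≡-Reasoning

walk-from-zero-cannot-fall : ∀ {j k} w → Walk 0 w j → ¬ Walk (suc k) w 0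
walk-from-zero-cannot-fall w p q with walk-displacement w p q
... | ()

walk-raise : ∀ k {h e} w → Walk h w e → Walk (k + h) w (k + e)
walk-raise k [] p = cong (k +_) p
walk-raise k {h} {e} (U ∷ w) p = subst (λ z → Walk z w (k + e)) (+-suc k h) (walk-raise k w p)
walk-raise k {suc h} (D ∷ w) p rewrite +-suc k h = walk-raise k w p

dyck-at : ∀ k X → Dyck X → Walk k X k
dyck-at k X p = subst₂ (λ a b → Walk a X b) (+-identityʳ k) (+-identityʳ k) (walk-raise k X p)

skip-dyck : ∀ {h e} X {ys} → Dyck X → Walk h (X ++ ys) e → Walk h ys e
skip-dyck {h} {e} X {ys} pX p with walk-++⁻ X p
... | k , pX′ , pys = subst (λ z → Walk z ys e) k≡h pys
  where
  k≡h : k ≡ h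
  k≡h = trans (walk-displacement X pX pX′) (+-identityʳ h)

concat-dyck : ∀ {Ys} → All Dyck Ys → Dyck (concat Ys)
concat-dyck [] = refl
concat-dyck {Y ∷ _} (pY ∷ pYs) = walk-++ Y pY (concat-dyck pYs)

walk-after-ups : ∀ m {h e} w → Walk (m + h) w e → Walk h (replicate m U ++ w) e
walk-after-ups zero w p = p
walk-after-ups (suc m) {h} {e} w p = walk-after-ups m w (subst (λ z → Walk z w e) (sym (+-suc m h)) p)

glue-walk : ∀ Ys j → length Ys ≡ suc j → All Dyck Ys → Walk j (glue Ys) 0
glue-walk (Y ∷ []) zero _ (pY ∷ []) = pY
glue-walk (Y ∷ Ys@(_ ∷ _)) (suc j) len (pY ∷ pYs) =
  walk-++ Y (dyck-at (suc j) Y pY) (glue-walk Ys j (suc-injective len) pYs)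

walk⇒prefix-bound : ∀ {h e} w → Walk h w e → ∀ n → downs (take n w) ≤ h + ups (take n w)
walk⇒prefix-bound w p zero = z≤n
walk⇒prefix-bound [] p (suc n) = z≤n
walk⇒prefix-bound {h} (U ∷ w) p (suc n) =
  subst (downs (take n w) ≤_) (sym (+-suc h _)) (walk⇒prefix-bound w p n)
walk⇒prefix-bound {suc h} (D ∷ w) p (suc n) = s≤s (walk⇒prefix-bound w p n)

prefix-bound⇒walk : ∀ h e w → (∀ n → downs (take n w) ≤ h + ups (take n w)) →
  h + ups w ≡ e + downs w → Walk h w e
prefix-bound⇒walk h e [] _ bal = trans (sym (+-identityʳ h)) (trans bal (+-identityʳ e))
prefix-bound⇒walk h e (U ∷ w) bound bal =
  prefix-bound⇒walk (suc h) e w (λ n → subst (downs (take n w) ≤_) (+-suc h _) (bound (suc n)))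
    (trans (sym (+-suc h _)) bal)
prefix-bound⇒walk zero e (D ∷ w) bound bal with bound 1
... | ()
prefix-bound⇒walk (suc h) e (D ∷ w) bound bal =
  prefix-bound⇒walk h e w (λ n → ≤-pred (bound (suc n))) (suc-injective (trans bal (+-suc e _)))

IsDyck⇒Dyck : ∀ {w} → IsDyck w → Dyck w
IsDyck⇒Dyck {w} (bound , bal) = prefix-bound⇒walk 0 0 w bound bal

Dyck⇒IsDyck : ∀ {w} → Dyck w → IsDyck w
Dyck⇒IsDyck {w} p = walk⇒prefix-bound w p , walk-balance w p

-- The displayed D is the first step of w below height k + 1; X is measured from height k + 1.
first-descent : ∀ j k w → Walk (suc (j + k)) w 0 →
  ∃₂ λ X w′ → w ≡ X ++ D ∷ w′ × Walk j X 0 × Walk k w′ 0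
first-descent j k (U ∷ w) p with first-descent (suc j) k w p
... | X , w′ , refl , pX , pw′ = U ∷ X , w′ , refl , pX , pw′
first-descent zero k (D ∷ w) p = [] , w , refl , refl , p
first-descent (suc j) k (D ∷ w) p with first-descent j k w p
... | X , w′ , refl , pX , pw′ = D ∷ X , w′ , refl , pX , pw′

data Arches : Word → Set where
  []  : Arches []
  _∷_ : ∀ {X E} → Dyck X → Arches E → Arches (U ∷ X ++ D ∷ E)

dyck⇒arches : ∀ {w} → Dyck w → Arches w
dyck⇒arches {w} = go (length w) w ≤-refl
  where
  go : ∀ fuel w → length w ≤ fuel → Dyck w → Arches w
  go _ [] _ _ = []
  go (suc fuel) (U ∷ w) (s≤s w≤fuel) p with first-descent 0 0 w p
  ... | X , E , refl , pX , pE = pX ∷ go fuel E E≤fuel pE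
    where
    E≤fuel : length E ≤ fuel
    E≤fuel = ≤-trans (n≤1+n _) (≤-trans (length-++-≤ʳ (D ∷ E) {X}) w≤fuel)

++-split : ∀ {A : Set} (xs ys : List A) {zs ws} → xs ++ zs ≡ ys ++ ws →
  (∃ λ t → ys ≡ xs ++ t × zs ≡ t ++ ws) ⊎ (∃₂ λ y t → xs ≡ ys ++ y ∷ t × ws ≡ y ∷ t ++ zs)
++-split [] ys eq = inj₁ (ys , refl , eq)
++-split (x ∷ xs) [] eq = inj₂ (x , xs , refl , sym eq)
++-split (x ∷ xs) (y ∷ ys) eq with ∷-injective eq
... | refl , eq′ with ++-split xs ys eq′
... | inj₁ (t , refl , e) = inj₁ (t , refl , e)
... | inj₂ (z , t , refl , e) = inj₂ (z , t , refl , e)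

[]≢++∷ : ∀ (A : Word) {x r} → [] ≢ A ++ x ∷ r
[]≢++∷ [] ()
[]≢++∷ (_ ∷ _) ()

++-shorter-prefix : ∀ {A : Set} (xs ys : List A) {zs ws} → xs ++ zs ≡ ys ++ ws →
  length xs ≤ length ys → ∃ λ t → ys ≡ xs ++ t × zs ≡ t ++ ws
++-shorter-prefix xs ys eq xs≤ys with ++-split xs ys eq
... | inj₁ r = r
... | inj₂ (y , t , refl , _) = ⊥-elim (<⇒≱ ys<xs xs≤ys)
  where
  ys<xs : length ys < length (ys ++ y ∷ t)
  ys<xs = ≤-trans (s≤s (length-++-≤ˡ ys)) (≤-reflexive (sym (length-++-sucʳ ys y t)))

take-++-≤ : ∀ {A : Set} (xs ys : List A) k → k ≤ length xs → take k (xs ++ ys) ≡ take k xs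
take-++-≤ xs ys zero _ = refl
take-++-≤ (x ∷ xs) ys (suc k) (s≤s k≤) = cong (x ∷_) (take-++-≤ xs ys k k≤)

take-length-+-++ : ∀ {A : Set} (xs ys : List A) j → take (length xs + j) (xs ++ ys) ≡ xs ++ take j ys
take-length-+-++ [] ys j = refl
take-length-+-++ (x ∷ xs) ys j = cong (x ∷_) (take-length-+-++ xs ys j)

take-length-++ : ∀ {A : Set} (xs ys : List A) → take (length xs) (xs ++ ys) ≡ xs
take-length-++ [] ys = refl
take-length-++ (x ∷ xs) ys = cong (x ∷_) (take-length-++ xs ys)

ups-++ : ∀ xs ys → ups (xs ++ ys) ≡ ups xs + ups ys
ups-++ [] ys = refl
ups-++ (U ∷ xs) ys = cong suc (ups-++ xs ys)
ups-++ (D ∷ xs) ys = ups-++ xs ys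

downs-++ : ∀ xs ys → downs (xs ++ ys) ≡ downs xs + downs ys
downs-++ [] ys = refl
downs-++ (U ∷ xs) ys = downs-++ xs ys
downs-++ (D ∷ xs) ys = cong suc (downs-++ xs ys)

+-reassoc : ∀ a b c d → a + b + (c + d) ≡ a + (b + c + d)
+-reassoc = solve-∀

-- Tamari covers

record CoverAt (P Q : Word) : Set where
  constructor at
  field
    A X B  : Word
    dyck-X : Dyck X
    source : P ≡ A ++ D ∷ U ∷ X ++ D ∷ B
    target : Q ≡ A ++ U ∷ X ++ D ∷ D ∷ B

cover : ∀ A X B → Dyck X → Cover (A ++ D ∷ U ∷ X ++ D ∷ B) (A ++ U ∷ X ++ D ∷ D ∷ B)
cover A X B pX = A , X , B , Dyck⇒IsDyck pX ,
  cong (λ z → A ++ D ∷ U ∷ z) (sym (++-assoc X (D ∷ []) B)) ,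
  cong (λ z → A ++ U ∷ z) (sym (++-assoc X (D ∷ []) (D ∷ B)))

cover-at : ∀ {P Q} → Cover P Q → CoverAt P Q
cover-at (A , X , B , pX , refl , refl) = at A X B (IsDyck⇒Dyck pX)
  (cong (λ z → A ++ D ∷ U ∷ z) (++-assoc X (D ∷ []) B))
  (cong (λ z → A ++ U ∷ z) (++-assoc X (D ∷ []) (D ∷ B)))

cover-++ˡ : ∀ L {P Q} → Cover P Q → Cover (L ++ P) (L ++ Q)
cover-++ˡ L c with cover-at c
... | at A X B pX refl refl = subst₂ Cover (++-assoc L A _) (++-assoc L A _) (cover (L ++ A) X B pX)

cover-++ʳ : ∀ R {P Q} → Cover P Q → Cover (P ++ R) (Q ++ R)
cover-++ʳ R c with cover-at c
... | at A X B pX refl refl = subst₂ Cover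
  (sym (trans (++-assoc A _ R) (cong (λ z → A ++ D ∷ U ∷ z) (++-assoc X (D ∷ B) R))))
  (sym (trans (++-assoc A _ R) (cong (λ z → A ++ U ∷ z) (++-assoc X (D ∷ D ∷ B) R))))
  (cover A X (B ++ R) pX)

≤T-++ˡ : ∀ L {P Q} → P ≤T Q → (L ++ P) ≤T (L ++ Q)
≤T-++ˡ L = gmap (L ++_) (cover-++ˡ L)

swap-length : ∀ A X B → length (A ++ D ∷ U ∷ X ++ D ∷ B) ≡ length (A ++ U ∷ X ++ D ∷ D ∷ B)
swap-length A X B = begin
  length (A ++ D ∷ U ∷ X ++ D ∷ B)      ≡⟨ length-++ A ⟩
  length A + suc (suc (length (X ++ D ∷ B)))  ≡⟨ cong (λ z → length A + suc z) (length-++-sucʳ X D (D ∷ B)) ⟨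
  length A + suc (length (X ++ D ∷ D ∷ B))     ≡⟨ length-++ A ⟨
  length (A ++ U ∷ X ++ D ∷ D ∷ B)      ∎
  where open ≡-Reasoning

≤T-length : ∀ {P Q} → P ≤T Q → length P ≡ length Q
≤T-length = fold (λ P Q → length P ≡ length Q) (λ c eq → trans (cover-length c) eq) refl
  where
  cover-length : ∀ {P Q} → Cover P Q → length P ≡ length Q
  cover-length c with cover-at c
  ... | at A X B _ refl refl = swap-length A X B

walk-swap⁺ : ∀ {h e} A X t → Dyck X →
  Walk h (A ++ D ∷ U ∷ X ++ D ∷ t) e → Walk h (A ++ U ∷ X ++ D ∷ D ∷ t) e
walk-swap⁺ A X t pX p with walk-++⁻ A p
... | suc a , pA , p′ = walk-++ A pA (walk-++ X (dyck-at (suc (suc a)) X pX) (skip-dyck X pX p′))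

walk-swap⁻ : ∀ {h e} A X t → Dyck X →
  Walk h (A ++ U ∷ X ++ D ∷ D ∷ t) e → Walk h (A ++ D ∷ U ∷ X ++ D ∷ t) e
walk-swap⁻ A X t pX p with walk-++⁻ A p
... | suc a , pA , p′ = walk-++ A pA (walk-++ X (dyck-at (suc a) X pX) (skip-dyck X pX p′))
... | zero , _ , p′ with () ← skip-dyck X pX p′

++-arch : ∀ L X T → (L ++ U ∷ X ++ D ∷ []) ++ T ≡ L ++ U ∷ X ++ D ∷ T
++-arch L X T = trans (++-assoc L _ T) (cong (λ z → L ++ U ∷ z) (++-assoc X (D ∷ []) T))

down-past-dyck : ∀ {E} → Arches E → ∀ L R → (L ++ D ∷ E ++ R) ≤T (L ++ E ++ D ∷ R)
down-past-dyck [] L R = ε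
down-past-dyck (_∷_ {X} {E} pX arches) L R = begin
  L ++ D ∷ (U ∷ X ++ D ∷ E) ++ R   ≡⟨ cong (λ z → L ++ D ∷ U ∷ z) (++-assoc X (D ∷ E) R) ⟩
  L ++ D ∷ U ∷ X ++ D ∷ E ++ R     ⟶⟨ cover L X (E ++ R) pX ⟩
  L ++ U ∷ X ++ D ∷ D ∷ E ++ R     ≡⟨ arch-assoc (D ∷ E ++ R) ⟨
  L′ ++ D ∷ E ++ R                 ⟶*⟨ down-past-dyck arches L′ R ⟩
  L′ ++ E ++ D ∷ R                 ≡⟨ arch-assoc (E ++ D ∷ R) ⟩
  L ++ U ∷ X ++ D ∷ E ++ D ∷ R     ≡⟨ cong (λ z → L ++ U ∷ z) (++-assoc X (D ∷ E) (D ∷ R)) ⟨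
  L ++ (U ∷ X ++ D ∷ E) ++ D ∷ R   ∎
  where
  open StarReasoning Cover
  L′ = L ++ U ∷ X ++ D ∷ []
  arch-assoc : ∀ T → L′ ++ T ≡ L ++ U ∷ X ++ D ∷ T
  arch-assoc = ++-arch L X

-- A cover needs a D in front of its excursion, so it never touches an initial run of up steps.
ups-prefix-of-++-D : ∀ m W A {r} → replicate m U ++ W ≡ A ++ D ∷ r →
  ∃ λ A′ → A ≡ replicate m U ++ A′ × W ≡ A′ ++ D ∷ r
ups-prefix-of-++-D zero W A eq = A , refl , eq
ups-prefix-of-++-D (suc m) W (U ∷ A) eq with ups-prefix-of-++-D m W A (∷-injectiveʳ eq)
... | A′ , refl , W≡ = A′ , refl , W≡

≤T-under-ups : ∀ m {R S} W → R ≡ replicate m U ++ W → R ≤T S →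
  ∃ λ S′ → S ≡ replicate m U ++ S′ × W ≤T S′
≤T-under-ups m W R≡ ε = W , R≡ , ε
≤T-under-ups m W R≡ (c ◅ s) with cover-at c
... | at A X B pX source refl with ups-prefix-of-++-D m W A (trans (sym R≡) source)
...   | A′ , refl , refl with ≤T-under-ups m (A′ ++ U ∷ X ++ D ∷ D ∷ B) (++-assoc (replicate m U) A′ _) s
...     | S′ , S≡ , s′ = S′ , S≡ , cover A′ X B pX ◅ s′

≤T-cancel-ups : ∀ m {W W′} → (replicate m U ++ W) ≤T (replicate m U ++ W′) → W ≤T W′
≤T-cancel-ups m {W} s with ≤T-under-ups m W refl s
... | S′ , S≡ , W≤S′ = subst (W ≤T_) (sym (++-cancelˡ (replicate m U) _ _ S≡)) W≤S′

-- The factorisations glue and concat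

glue-tail : List Word → Word
glue-tail [] = []
glue-tail (V ∷ Vs) = D ∷ glue (V ∷ Vs)

glue-cons : ∀ W Vs → glue (W ∷ Vs) ≡ W ++ glue-tail Vs
glue-cons W [] = sym (++-identityʳ W)
glue-cons W (V ∷ Vs) = refl

glue-tail≢U∷ : ∀ Ys {r} → glue-tail Ys ≢ U ∷ r
glue-tail≢U∷ [] ()
glue-tail≢U∷ (_ ∷ _) ()

glue-∷ʳ : ∀ Y I Z → glue ((Y ∷ I) ∷ʳ Z) ≡ glue (Y ∷ I) ++ D ∷ Z
glue-∷ʳ Y [] Z = refl
glue-∷ʳ Y (Y₂ ∷ I) Z = trans (cong (λ w → Y ++ D ∷ w) (glue-∷ʳ Y₂ I Z)) (sym (++-assoc Y _ _))

boundary : List Word → ℕ → ℕ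
boundary _ zero = 0
boundary [] (suc _) = 0
boundary (Y ∷ Ys) (suc k) = length Y + boundary Ys k

_≼_ : List Word → List Word → Set
Ys ≼ Zs = ∀ k → boundary Ys k ≤ boundary Zs k

boundary-lengths : ∀ Vs Ws → map length Vs ≡ map length Ws → ∀ k → boundary Vs k ≡ boundary Ws k
boundary-lengths _ _ _ zero = refl
boundary-lengths [] [] _ (suc k) = refl
boundary-lengths (V ∷ Vs) (W ∷ Ws) eq (suc k) with ∷-injective eq
... | |V|≡|W| , rest≡ = cong₂ _+_ |V|≡|W| (boundary-lengths Vs Ws rest≡ k)

boundary≡length-concat-take : ∀ Ys k → boundary Ys k ≡ length (concat (take k Ys))
boundary≡length-concat-take _ zero = refl
boundary≡length-concat-take [] (suc k) = refl
boundary≡length-concat-take (Y ∷ Ys) (suc k) =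
  trans (cong (length Y +_) (boundary≡length-concat-take Ys k)) (sym (length-++ Y))

boundary-beyond : ∀ Ys k → length Ys ≤ k → boundary Ys k ≡ length (concat Ys)
boundary-beyond [] zero _ = refl
boundary-beyond [] (suc k) _ = refl
boundary-beyond (Y ∷ Ys) (suc k) (s≤s |Ys|≤k) =
  trans (cong (length Y +_) (boundary-beyond Ys k |Ys|≤k)) (sym (length-++ Y))

dyck-++-D-cancel : ∀ Y Z {R R′} → Dyck Y → Dyck Z → Y ++ D ∷ R ≡ Z ++ D ∷ R′ → Y ≡ Z × R ≡ R′
dyck-++-D-cancel Y Z pY pZ eq with ++-split Y Z eq
... | inj₁ ([] , refl , eq′) = sym (++-identityʳ Y) , ∷-injectiveʳ eq′
... | inj₁ (D ∷ t , refl , _) with () ← skip-dyck Y pY pZ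
... | inj₂ (D , t , refl , _) with () ← skip-dyck Z pZ pY

glue-injective : ∀ Ys Zs → All Dyck Ys → All Dyck Zs → length Ys ≡ length Zs → glue Ys ≡ glue Zs → Ys ≡ Zs
glue-injective [] [] _ _ _ _ = refl
glue-injective (Y ∷ []) (Z ∷ []) _ _ _ Y≡Z = cong (_∷ []) Y≡Z
glue-injective (Y ∷ Ys@(_ ∷ _)) (Z ∷ Zs@(_ ∷ _)) (pY ∷ pYs) (pZ ∷ pZs) len eq
  with dyck-++-D-cancel Y Z pY pZ eq
... | refl , rest≡ = cong (Y ∷_) (glue-injective Ys Zs pYs pZs (suc-injective len) rest≡)

≼⇒glue-≤T : ∀ Ys Ws → All Dyck Ys → All Dyck Ws → length Ys ≡ length Ws →
  concat Ys ≡ concat Ws → Ys ≼ Ws → glue Ys ≤T glue Ws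
≼⇒glue-≤T [] [] _ _ _ _ _ = ε
≼⇒glue-≤T (Y ∷ []) (W ∷ []) _ _ _ concat≡ _ = Star-reflexive Cover (++-cancelʳ [] Y W concat≡)
≼⇒glue-≤T (Y ∷ Y₂ ∷ Ys) (W ∷ W₂ ∷ Ws) (pY ∷ pYs) (pW ∷ pW₂ ∷ pWs) |Ys|≡|Ws| concat≡ Ys≼Ws
  with ++-shorter-prefix Y W concat≡ (+-cancelʳ-≤ 0 _ _ (Ys≼Ws 1))
... | E , refl , rest≡ = begin
  Y ++ D ∷ glue (Y₂ ∷ Ys)                 ⟶*⟨ ≤T-++ˡ Y (≤T-++ˡ (D ∷ []) tail≤) ⟩
  Y ++ D ∷ glue ((E ++ W₂) ∷ Ws)          ≡⟨ cong (λ z → Y ++ D ∷ z) (glue-cons (E ++ W₂) Ws) ⟩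
  Y ++ D ∷ (E ++ W₂) ++ glue-tail Ws      ≡⟨ cong (λ z → Y ++ D ∷ z) (++-assoc E W₂ _) ⟩
  Y ++ D ∷ E ++ W₂ ++ glue-tail Ws        ⟶*⟨ down-past-dyck (dyck⇒arches pE) Y (W₂ ++ glue-tail Ws) ⟩
  Y ++ E ++ D ∷ W₂ ++ glue-tail Ws        ≡⟨ cong (λ z → Y ++ E ++ D ∷ z) (glue-cons W₂ Ws) ⟨
  Y ++ E ++ D ∷ glue (W₂ ∷ Ws)            ≡⟨ ++-assoc Y E _ ⟨
  (Y ++ E) ++ D ∷ glue (W₂ ∷ Ws)          ∎
  where
  open StarReasoning Cover
  pE : Dyck E
  pE = skip-dyck Y pY pW
  regroup : ∀ b → length (Y ++ E) + (length W₂ + b) ≡ length Y + (length (E ++ W₂) + b)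
  regroup b rewrite length-++ Y {E} | length-++ E {W₂} = +-reassoc (length Y) (length E) (length W₂) b
  shifted : (Y₂ ∷ Ys) ≼ ((E ++ W₂) ∷ Ws)
  shifted zero = z≤n
  shifted (suc k) = +-cancelˡ-≤ (length Y) _ _
    (≤-trans (Ys≼Ws (suc (suc k))) (≤-reflexive (regroup (boundary Ws k))))
  tail≤ : glue (Y₂ ∷ Ys) ≤T glue ((E ++ W₂) ∷ Ws)
  tail≤ = ≼⇒glue-≤T (Y₂ ∷ Ys) ((E ++ W₂) ∷ Ws) pYs (walk-++ E pE pW₂ ∷ pWs) (suc-injective |Ys|≡|Ws|)
    (trans rest≡ (sym (++-assoc E W₂ _))) shifted

excursion-prefix : ∀ {k T} W X B → Walk k W 0 → Dyck X → (∀ {r} → T ≢ U ∷ r) →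
  W ++ T ≡ U ∷ X ++ D ∷ B → ∃ λ W′ → W ≡ U ∷ X ++ D ∷ W′ × B ≡ W′ ++ T
excursion-prefix [] X B pW pX T≢U eq = ⊥-elim (T≢U eq)
excursion-prefix (U ∷ W) X B pW pX T≢U eq with ++-split W X (∷-injectiveʳ eq)
... | inj₂ (.D , W′ , refl , refl) = W′ , refl , refl
... | inj₁ (t , refl , _) with walk-++⁻ W pX
...   | _ , pW₀ , _ = ⊥-elim (walk-from-zero-cannot-fall W pW₀ pW)

record FactorsAbove (Ys : List Word) (S : Word) : Set where
  constructor factorsAbove
  field
    Zs          : List Word
    dyck        : All Dyck Zs
    same-length : length Zs ≡ length Ys
    glue≡       : glue Zs ≡ S
    concat≤     : concat Ys ≤T concat Zs
    Ys≼Zs       : Ys ≼ Zs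

factors-above-swap-in-head : ∀ A X W′ Ys → Dyck X → All Dyck ((A ++ D ∷ U ∷ X ++ D ∷ W′) ∷ Ys) →
  FactorsAbove ((A ++ D ∷ U ∷ X ++ D ∷ W′) ∷ Ys) (glue ((A ++ U ∷ X ++ D ∷ D ∷ W′) ∷ Ys))
factors-above-swap-in-head A X W′ Ys pX (pY ∷ pYs) = factorsAbove
  ((A ++ U ∷ X ++ D ∷ D ∷ W′) ∷ Ys) (walk-swap⁺ A X W′ pX pY ∷ pYs) refl refl
  (cover-++ʳ (concat Ys) (cover A X W′ pX) ◅ ε)
  λ { zero → z≤n ; (suc k) → ≤-reflexive (cong (_+ boundary Ys k) (swap-length A X W′)) }

factors-above-move-across-separator : ∀ Y M Y₂ Ys → Dyck Y → Dyck M → Dyck Y₂ → All Dyck Ys →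
  FactorsAbove (Y ∷ (M ++ Y₂) ∷ Ys) (glue ((Y ++ M) ∷ Y₂ ∷ Ys))
factors-above-move-across-separator Y M Y₂ Ys pY pM pY₂ pYs = factorsAbove
  ((Y ++ M) ∷ Y₂ ∷ Ys) (walk-++ Y pY pM ∷ pY₂ ∷ pYs) refl refl
  (Star-reflexive Cover (trans (cong (Y ++_) (++-assoc M Y₂ _)) (sym (++-assoc Y M _)))) moved
  where
  moved : (Y ∷ (M ++ Y₂) ∷ Ys) ≼ ((Y ++ M) ∷ Y₂ ∷ Ys)
  moved zero = z≤n
  moved (suc zero) = +-monoˡ-≤ 0 (length-++-≤ˡ Y)
  moved (suc (suc k)) rewrite length-++ Y {M} | length-++ M {Y₂} =
    ≤-reflexive (sym (+-reassoc (length Y) (length M) (length Y₂) (boundary Ys k)))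

factors-above-cons : ∀ Y Y₂ Ys {S} → Dyck Y → FactorsAbove (Y₂ ∷ Ys) S →
  FactorsAbove (Y ∷ Y₂ ∷ Ys) (Y ++ D ∷ S)
factors-above-cons Y Y₂ Ys pY (factorsAbove (Z ∷ Zs) pZs len refl concat≤ Ys≼Zs) =
  factorsAbove (Y ∷ Z ∷ Zs) (pY ∷ pZs) (cong suc len) refl (≤T-++ˡ Y concat≤) shifted
  where
  shifted : (Y ∷ Y₂ ∷ Ys) ≼ (Y ∷ Z ∷ Zs)
  shifted zero = z≤n
  shifted (suc k) = +-monoʳ-≤ (length Y) (Ys≼Zs k)

cover-at-separator : ∀ Y Y₂ Ys X B → Dyck Y → All Dyck (Y₂ ∷ Ys) → Dyck X →
  glue (Y₂ ∷ Ys) ≡ U ∷ X ++ D ∷ B → FactorsAbove (Y ∷ Y₂ ∷ Ys) (Y ++ U ∷ X ++ D ∷ D ∷ B)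
cover-at-separator Y Y₂ Ys X B pY (pY₂ ∷ pYs) pX eq
  with excursion-prefix Y₂ X B pY₂ pX (glue-tail≢U∷ Ys) (trans (sym (glue-cons Y₂ Ys)) eq)
... | Y₂′ , refl , refl =
  subst₂ FactorsAbove (cong (λ Z → Y ∷ (U ∷ Z) ∷ Ys) (++-assoc X (D ∷ []) Y₂′)) glued
    (factors-above-move-across-separator Y (U ∷ X ++ D ∷ []) Y₂′ Ys pY (walk-++ X (dyck-at 1 X pX) refl)
      (skip-dyck X pX pY₂) pYs)
  where
  glued : (Y ++ U ∷ X ++ D ∷ []) ++ D ∷ glue (Y₂′ ∷ Ys) ≡ Y ++ U ∷ X ++ D ∷ D ∷ Y₂′ ++ glue-tail Ys
  glued = trans (++-arch Y X _) (cong (λ T → Y ++ U ∷ X ++ D ∷ D ∷ T) (glue-cons Y₂′ Ys))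

cover-in-head : ∀ A T Y₂ Ys X B → Dyck (A ++ D ∷ T) → All Dyck (Y₂ ∷ Ys) → Dyck X →
  T ++ D ∷ glue (Y₂ ∷ Ys) ≡ U ∷ X ++ D ∷ B →
  FactorsAbove ((A ++ D ∷ T) ∷ Y₂ ∷ Ys) (A ++ U ∷ X ++ D ∷ D ∷ B)
cover-in-head A T Y₂ Ys X B pY pYs pX eq with walk-++⁻ A pY
... | suc a , _ , pT with excursion-prefix T X B pT pX (λ ()) eq
... | W′ , refl , refl = subst (FactorsAbove _) glued (factors-above-swap-in-head A X W′ (Y₂ ∷ Ys) pX (pY ∷ pYs))
  where
  glued : (A ++ U ∷ X ++ D ∷ D ∷ W′) ++ D ∷ glue (Y₂ ∷ Ys)
        ≡ A ++ U ∷ X ++ D ∷ D ∷ W′ ++ D ∷ glue (Y₂ ∷ Ys)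
  glued = trans (++-assoc A _ _) (cong (λ z → A ++ U ∷ z) (++-assoc X (D ∷ D ∷ W′) _))

cover-glue⇒factors-above : ∀ Ys A X B → All Dyck Ys → Dyck X →
  glue Ys ≡ A ++ D ∷ U ∷ X ++ D ∷ B → FactorsAbove Ys (A ++ U ∷ X ++ D ∷ D ∷ B)
cover-glue⇒factors-above [] A X B _ _ eq = ⊥-elim ([]≢++∷ A eq)
cover-glue⇒factors-above (Y ∷ []) A X B pYs pX refl = factors-above-swap-in-head A X B [] pX pYs
cover-glue⇒factors-above (Y ∷ Ys@(Y₂ ∷ Ys′)) A X B (pY ∷ pYs) pX eq with ++-split Y A eq
... | inj₁ ([] , refl , eq′) =
  subst (FactorsAbove _) (cong (_++ _) (sym (++-identityʳ Y)))
    (cover-at-separator Y Y₂ Ys′ X B pY pYs pX (∷-injectiveʳ eq′))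
... | inj₁ (D ∷ t , refl , eq′) =
  subst (FactorsAbove _) (sym (++-assoc Y (D ∷ t) _))
    (factors-above-cons Y Y₂ Ys′ pY (cover-glue⇒factors-above Ys t X B pYs pX (∷-injectiveʳ eq′)))
... | inj₂ (y , T , refl , eq′) with ∷-injective eq′
...   | refl , eq″ = cover-in-head A T Y₂ Ys′ X B pY pYs pX (sym eq″)

glue-≤T⇒factors-above : ∀ Ys {R S} → All Dyck Ys → glue Ys ≡ R → R ≤T S → FactorsAbove Ys S
glue-≤T⇒factors-above Ys pYs refl ε = factorsAbove Ys pYs refl refl ε (λ _ → ≤-refl)
glue-≤T⇒factors-above Ys pYs refl (c ◅ s) with cover-at c
... | at A X B pX source refl with cover-glue⇒factors-above Ys A X B pYs pX source
...   | factorsAbove Zs pZs len₁ glue₁ concat₁ Ys≼Zs with glue-≤T⇒factors-above Zs pZs glue₁ s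
...     | factorsAbove Ws pWs len₂ glue₂ concat₂ Zs≼Ws =
  factorsAbove Ws pWs (trans len₂ len₁) glue₂ (concat₁ ◅◅ concat₂) (λ k → ≤-trans (Ys≼Zs k) (Zs≼Ws k))

-- The interior vertices of U X D D are no lower than its start, which has height at least 1 since
-- the factor ends one step lower; so the contact between the Dyck words L and M is not inside it.
swap-within-one-factor : ∀ L M A X B → Dyck L → Dyck M → Dyck X → L ++ M ≡ A ++ U ∷ X ++ D ∷ D ∷ B →
  (∃ λ t → A ≡ L ++ t × M ≡ t ++ U ∷ X ++ D ∷ D ∷ B) ⊎
  (∃ λ t → L ≡ A ++ U ∷ X ++ D ∷ D ∷ t × B ≡ t ++ M)
swap-within-one-factor L M A X B pL pM pX eq with ++-split L A eq
... | inj₁ r = inj₁ r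
... | inj₂ (y , T , refl , eq′) with ∷-injective eq′
...   | refl , eq″ with ++-split T X (sym eq″)
...     | inj₂ (D , [] , refl , refl) with () ← pM
...     | inj₂ (D , D ∷ t , refl , refl) = inj₂ (t , refl , refl)
...     | inj₁ (t , refl , _) with walk-++⁻ A pL | walk-++⁻ T pX
...       | _ , _ , pT | _ , pT₀ , _ = ⊥-elim (walk-from-zero-cannot-fall T pT₀ pT)

record FactorsBelow (R : Word) (Ws : List Word) : Set where
  constructor factorsBelow
  field
    Vs           : List Word
    dyck         : All Dyck Vs
    same-lengths : map length Vs ≡ map length Ws
    concat≡      : concat Vs ≡ R
    glue≤        : glue Vs ≤T glue Ws

factors-below-cons : ∀ W {R Ws} → Dyck W → FactorsBelow R Ws → FactorsBelow (W ++ R) (W ∷ Ws)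
factors-below-cons W pW (factorsBelow Vs pVs lengths refl glue≤) =
  factorsBelow (W ∷ Vs) (pW ∷ pVs) (cong (length W ∷_) lengths) refl
    (subst₂ _≤T_ (sym (glue-cons W Vs)) (sym (glue-cons W _)) (≤T-++ˡ W (tail≤ Vs _ lengths glue≤)))
  where
  tail≤ : ∀ Vs Ws → map length Vs ≡ map length Ws → glue Vs ≤T glue Ws → glue-tail Vs ≤T glue-tail Ws
  tail≤ [] [] _ _ = ε
  tail≤ (_ ∷ _) (_ ∷ _) _ glue≤ = ≤T-++ˡ (D ∷ []) glue≤

cover-concat⇒factors-below : ∀ Ws A X B → All Dyck Ws → Dyck X →
  concat Ws ≡ A ++ U ∷ X ++ D ∷ D ∷ B → FactorsBelow (A ++ D ∷ U ∷ X ++ D ∷ B) Ws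
cover-concat⇒factors-below [] A X B _ _ eq = ⊥-elim ([]≢++∷ A eq)
cover-concat⇒factors-below (W ∷ Ws) A X B (pW ∷ pWs) pX eq
  with swap-within-one-factor W (concat Ws) A X B pW (concat-dyck pWs) pX eq
... | inj₁ (t , refl , eq′) =
  subst (λ R → FactorsBelow R (W ∷ Ws)) (sym (++-assoc W t _))
    (factors-below-cons W pW (cover-concat⇒factors-below Ws t X B pWs pX eq′))
... | inj₂ (t , refl , refl) = factorsBelow (W′ ∷ Ws) (walk-swap⁻ A X t pX pW ∷ pWs)
  (cong (_∷ map length Ws) (swap-length A X t))
  (trans (++-assoc A _ _) (cong (λ z → A ++ D ∷ U ∷ z) (++-assoc X (D ∷ t) _)))
  (subst₂ Cover (sym (glue-cons W′ Ws)) (sym (glue-cons _ Ws)) (cover-++ʳ (glue-tail Ws) (cover A X t pX)) ◅ ε)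
  where
  W′ = A ++ D ∷ U ∷ X ++ D ∷ t

≤T-concat⇒factors-below : ∀ Ws {R S} → All Dyck Ws → R ≤T S → S ≡ concat Ws → FactorsBelow R Ws
≤T-concat⇒factors-below Ws pWs ε refl = factorsBelow Ws pWs refl refl ε
≤T-concat⇒factors-below Ws pWs (c ◅ s) S≡ with ≤T-concat⇒factors-below Ws pWs s S≡ | cover-at c
... | factorsBelow Vs pVs lengths concat≡ glue≤ | at A X B pX refl target
  with cover-concat⇒factors-below Vs A X B pVs pX (trans concat≡ target)
...   | factorsBelow Us pUs lengths′ concat≡′ glue≤′ =
  factorsBelow Us pUs (trans lengths′ lengths) concat≡′ (glue≤′ ◅◅ glue≤)

glue-≤T⇔concat-≤T×≼ : ∀ Ys Ws → All Dyck Ys → All Dyck Ws → length Ys ≡ length Ws →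
  glue Ys ≤T glue Ws ⇔ (concat Ys ≤T concat Ws × Ys ≼ Ws)
glue-≤T⇔concat-≤T×≼ Ys Ws pYs pWs |Ys|≡|Ws| = mk⇔ to from
  where
  to : glue Ys ≤T glue Ws → concat Ys ≤T concat Ws × Ys ≼ Ws
  to glue≤ with glue-≤T⇒factors-above Ys pYs refl glue≤
  ... | factorsAbove Zs pZs len glue≡ concat≤ Ys≼Zs
    with glue-injective Zs Ws pZs pWs (trans len |Ys|≡|Ws|) glue≡
  ... | refl = concat≤ , Ys≼Zs
  from : concat Ys ≤T concat Ws × Ys ≼ Ws → glue Ys ≤T glue Ws
  from (concat≤ , Ys≼Ws) with ≤T-concat⇒factors-below Ws pWs concat≤ refl
  ... | factorsBelow Vs pVs lengths concat≡ glue≤ =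
    ≼⇒glue-≤T Ys Vs pYs pVs |Ys|≡|Vs| (sym concat≡) Ys≼Vs ◅◅ glue≤
    where
    |Ys|≡|Vs| : length Ys ≡ length Vs
    |Ys|≡|Vs| = trans |Ys|≡|Ws| (trans (sym (length-map length Ws))
      (trans (sym (cong length lengths)) (length-map length Vs)))
    Ys≼Vs : Ys ≼ Vs
    Ys≼Vs k = subst (boundary Ys k ≤_) (sym (boundary-lengths Vs Ws lengths k)) (Ys≼Ws k)

inner-boundaries⇒≼ : ∀ m Ys Ws → length Ys ≡ suc m → length Ws ≡ suc m →
  length (concat Ys) ≡ length (concat Ws) →
  (∀ (i : Fin m) → boundary Ys (suc (toℕ i)) ≤ boundary Ws (suc (toℕ i))) → Ys ≼ Ws
inner-boundaries⇒≼ m Ys Ws |Ys| |Ws| total inner zero = z≤n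
inner-boundaries⇒≼ m Ys Ws |Ys| |Ws| total inner (suc k) with k <? m
... | yes k<m = subst (λ j → boundary Ys (suc j) ≤ boundary Ws (suc j)) (toℕ-fromℕ< k<m) (inner (fromℕ< k<m))
... | no k≮m = ≤-reflexive (begin
  boundary Ys (suc k)   ≡⟨ boundary-beyond Ys (suc k) (≤-trans (≤-reflexive |Ys|) (s≤s (≮⇒≥ k≮m))) ⟩
  length (concat Ys)    ≡⟨ total ⟩
  length (concat Ws)    ≡⟨ boundary-beyond Ws (suc k) (≤-trans (≤-reflexive |Ws|) (s≤s (≮⇒≥ k≮m))) ⟨
  boundary Ws (suc k)   ∎)
  where open ≡-Reasoning

reduction-≤T⇔ : ∀ m {P Q P′ Q′ p q} → IsMReduction m P P′ p → IsMReduction m Q Q′ q →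
  (P ≤T Q) ⇔ (P′ ≤T Q′ × ∀ (i : Fin m) → p i ≤ q i)
reduction-≤T⇔ m (Ys , |Ys| , dyck-Ys , refl , refl , p≡) (Ws , |Ws| , dyck-Ws , refl , refl , q≡) =
  mk⇔ (λ P≤Q → reduced (to (≤T-cancel-ups m P≤Q)))
      (λ (P′≤Q′ , p≤q) → ≤T-++ˡ (replicate m U) (from (P′≤Q′ , boundaries P′≤Q′ p≤q)))
  where
  open Equivalence (glue-≤T⇔concat-≤T×≼ Ys Ws (All.map IsDyck⇒Dyck dyck-Ys) (All.map IsDyck⇒Dyck dyck-Ws)
    (trans |Ys| (sym |Ws|)))
  inner : ∀ Zs {r : Fin m → ℕ} → (∀ i → r i ≡ length (concat (take (suc (toℕ i)) Zs))) →
    ∀ i → r i ≡ boundary Zs (suc (toℕ i))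
  inner Zs r≡ i = trans (r≡ i) (sym (boundary≡length-concat-take Zs (suc (toℕ i))))
  reduced : concat Ys ≤T concat Ws × Ys ≼ Ws → concat Ys ≤T concat Ws × ∀ i → _
  reduced (c , Ys≼Ws) = c , λ i →
    subst₂ _≤_ (sym (inner Ys p≡ i)) (sym (inner Ws q≡ i)) (Ys≼Ws (suc (toℕ i)))
  boundaries : concat Ys ≤T concat Ws → (∀ i → _) → Ys ≼ Ws
  boundaries c p≤q = inner-boundaries⇒≼ m Ys Ws |Ys| |Ws| (≤T-length c)
    λ i → subst₂ _≤_ (inner Ys p≡ i) (inner Ws q≡ i) (p≤q i)

-- Contacts

contact-irrelevant : ∀ P k → Irrelevant (IsContact P k)
contact-irrelevant P k (a , b) (a′ , b′) = cong₂ _,_ (≤-irrelevant a a′) (≡-irrelevant b b′)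

contact-≡ : ∀ P {x y : Σ ℕ (IsContact P)} → proj₁ x ≡ proj₁ y → x ≡ y
contact-≡ P {k , c} {.k , c′} refl = cong (k ,_) (contact-irrelevant P k c c′)

bounded-contact-≡ : ∀ P a {x y : Σ ℕ λ k → IsContact P k × a ≤ k} → proj₁ x ≡ proj₁ y → x ≡ y
bounded-contact-≡ P a {k , c , a≤k} {.k , c′ , a≤k′} refl =
  cong₂ (λ c a≤k → k , c , a≤k) (contact-irrelevant P k c c′) (≤-irrelevant a≤k a≤k′)

contact-++⁻ : ∀ X Y j → ups X ≡ downs X → IsContact (X ++ Y) (length X + j) → IsContact Y j
contact-++⁻ X Y j balanced (j≤ , level) =
  +-cancelˡ-≤ (length X) _ _ (subst (length X + j ≤_) (length-++ X) j≤) ,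
  +-cancelˡ-≡ (ups X) _ _ (begin
    ups X + ups (take j Y)      ≡⟨ ups-++ X _ ⟨
    ups (X ++ take j Y)         ≡⟨ cong ups (take-length-+-++ X Y j) ⟨
    ups (take (length X + j) (X ++ Y))     ≡⟨ level ⟩
    downs (take (length X + j) (X ++ Y))   ≡⟨ cong downs (take-length-+-++ X Y j) ⟩
    downs (X ++ take j Y)       ≡⟨ downs-++ X _ ⟩
    downs X + downs (take j Y)  ≡⟨ cong (_+ _) balanced ⟨
    ups X + downs (take j Y)    ∎)
  where open ≡-Reasoning

contact-++ : ∀ X Y j → ups X ≡ downs X → IsContact Y j → IsContact (X ++ Y) (length X + j)
contact-++ X Y j balanced (j≤ , level) =
  subst (length X + j ≤_) (sym (length-++ X)) (+-monoʳ-≤ (length X) j≤) ,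
  (begin
    ups (take (length X + j) (X ++ Y))     ≡⟨ cong ups (take-length-+-++ X Y j) ⟩
    ups (X ++ take j Y)         ≡⟨ ups-++ X _ ⟩
    ups X + ups (take j Y)      ≡⟨ cong₂ _+_ balanced level ⟩
    downs X + downs (take j Y)  ≡⟨ downs-++ X _ ⟨
    downs (X ++ take j Y)       ≡⟨ cong downs (take-length-+-++ X Y j) ⟨
    downs (take (length X + j) (X ++ Y))   ∎)
  where open ≡-Reasoning

contacts-after-balanced : ∀ X Y → ups X ≡ downs X → ContactRightOf (X ++ Y) (length X) ↔ Σ ℕ (IsContact Y)
contacts-after-balanced X Y balanced = mk↔ₛ′ to from to∘from from∘to
  where
  to : ContactRightOf (X ++ Y) (length X) → Σ ℕ (IsContact Y)
  to (k , c , X≤k) = k ∸ length X ,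
    contact-++⁻ X Y _ balanced (subst (IsContact (X ++ Y)) (sym (m+[n∸m]≡n X≤k)) c)
  from : Σ ℕ (IsContact Y) → ContactRightOf (X ++ Y) (length X)
  from (j , c) = length X + j , contact-++ X Y j balanced c , m≤m+n _ _
  to∘from : ∀ y → to (from y) ≡ y
  to∘from (j , _) = contact-≡ Y (m+n∸m≡n (length X) j)
  from∘to : ∀ x → from (to x) ≡ x
  from∘to (k , _ , X≤k) = bounded-contact-≡ (X ++ Y) (length X) (m+[n∸m]≡n X≤k)

first-arch-contact : ∀ N Y k → Dyck N → IsContact ((U ∷ N ++ D ∷ []) ++ Y) k → 0 < k →
  length (U ∷ N ++ D ∷ []) ≤ k
first-arch-contact N Y (suc k) pN (_ , level) _ with k ≤? length N
... | no k≰N = s≤s (subst (_≤ k) (sym (trans (length-++ N) (+-comm (length N) 1))) (≰⇒> k≰N))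
... | yes k≤N = ⊥-elim (1+n≰n (≤-trans (≤-reflexive inside) (walk⇒prefix-bound N pN k)))
  where
  prefix : take k ((N ++ D ∷ []) ++ Y) ≡ take k N
  prefix = trans (cong (take k) (++-assoc N (D ∷ []) Y)) (take-++-≤ N (D ∷ Y) k k≤N)
  inside : suc (ups (take k N)) ≡ downs (take k N)
  inside = trans (cong (λ z → suc (ups z)) (sym prefix)) (trans level (cong downs prefix))

non-initial-contacts-after-arch : ∀ N Y → Dyck N →
  NonInitialContact ((U ∷ N ++ D ∷ []) ++ Y)
    ↔ ContactRightOf ((U ∷ N ++ D ∷ []) ++ Y) (length (U ∷ N ++ D ∷ []))
non-initial-contacts-after-arch N Y pN =
  mk↔ₛ′ to from (λ _ → bounded-contact-≡ _ _ refl) (λ _ → bounded-contact-≡ _ _ refl)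
  where
  to : NonInitialContact ((U ∷ N ++ D ∷ []) ++ Y) → ContactRightOf _ _
  to (k , c , 0<k) = k , c , first-arch-contact N Y k pN c 0<k
  from : ContactRightOf ((U ∷ N ++ D ∷ []) ++ Y) (length (U ∷ N ++ D ∷ [])) → NonInitialContact _
  from (k , c , arch≤k) = k , c , ≤-trans (s≤s z≤n) arch≤k

non-initial-contacts⤖contacts-after-dyck : ∀ N C Y → Dyck N → Dyck C →
  NonInitialContact ((U ∷ N ++ D ∷ []) ++ Y) ⤖ ContactRightOf (C ++ Y) (length C)
non-initial-contacts⤖contacts-after-dyck N C Y pN pC = ↔⇒⤖
  (↔-sym (contacts-after-balanced C Y (walk-balance C pC)) ↔-∘
    (contacts-after-balanced (U ∷ N ++ D ∷ []) Y (walk-balance (U ∷ N ++ D ∷ []) arch) ↔-∘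
     non-initial-contacts-after-arch N Y pN))
  where
  arch : Dyck (U ∷ N ++ D ∷ [])
  arch = walk-++ N (dyck-at 1 N pN) refl

arch-reduction-contacts⤖ : ∀ m Y I Z → length (Y ∷ I) ≡ suc m → All Dyck (Y ∷ I) →
  NonInitialContact (replicate (suc m) U ++ glue ((Y ∷ I) ∷ʳ Z))
    ⤖ ContactRightOf (concat ((Y ∷ I) ∷ʳ Z)) (length (concat (Y ∷ I)))
arch-reduction-contacts⤖ m Y I Z |I| dyck-I =
  subst₂ (λ P P′ → NonInitialContact P ⤖ ContactRightOf P′ (length (concat (Y ∷ I)))) (sym P≡) (sym P′≡)
    (non-initial-contacts⤖contacts-after-dyck N (concat (Y ∷ I)) Z dyck-N (concat-dyck dyck-I))
  where
  N = replicate m U ++ glue (Y ∷ I)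
  dyck-N : Dyck N
  dyck-N = walk-after-ups m (glue (Y ∷ I))
    (subst (λ j → Walk j (glue (Y ∷ I)) 0) (sym (+-identityʳ m)) (glue-walk (Y ∷ I) m |I| dyck-I))
  P≡ : replicate (suc m) U ++ glue ((Y ∷ I) ∷ʳ Z) ≡ (U ∷ N ++ D ∷ []) ++ Z
  P≡ = cong (U ∷_) (begin
    replicate m U ++ glue ((Y ∷ I) ∷ʳ Z)      ≡⟨ cong (replicate m U ++_) (glue-∷ʳ Y I Z) ⟩
    replicate m U ++ glue (Y ∷ I) ++ D ∷ Z    ≡⟨ ++-assoc (replicate m U) _ _ ⟨
    N ++ D ∷ Z                                ≡⟨ ++-assoc N (D ∷ []) Z ⟨
    (N ++ D ∷ []) ++ Z                        ∎)
    where open ≡-Reasoning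
  P′≡ : concat ((Y ∷ I) ∷ʳ Z) ≡ concat (Y ∷ I) ++ Z
  P′≡ = trans (sym (concat-++ (Y ∷ I) (Z ∷ []))) (cong (concat (Y ∷ I) ++_) (++-identityʳ Z))

reduction-contacts⤖ : ∀ m {P P′ p} → IsMReduction (suc m) P P′ p →
  NonInitialContact P ⤖ ContactRightOf P′ (p (fromℕ m))
reduction-contacts⤖ m {p = p} (Ys , |Ys| , dyck-Ys , refl , refl , p≡) with initLast Ys
... | (Y ∷ I) ∷ʳ′ Z = subst (λ a → NonInitialContact _ ⤖ ContactRightOf (concat Ys′) a) (sym p-last)
  (arch-reduction-contacts⤖ m Y I Z |I| (proj₁ (∷ʳ⁻ (All.map IsDyck⇒Dyck dyck-Ys))))
  where
  Ys′ = (Y ∷ I) ∷ʳ Z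
  |I| : length (Y ∷ I) ≡ suc m
  |I| = suc-injective (trans (trans (+-comm 1 (length (Y ∷ I))) (sym (length-++ (Y ∷ I)))) |Ys|)
  p-last : p (fromℕ m) ≡ length (concat (Y ∷ I))
  p-last = begin
    p (fromℕ m)                                         ≡⟨ p≡ (fromℕ m) ⟩
    length (concat (take (suc (toℕ (fromℕ m))) Ys′))   ≡⟨ cong (λ k → length (concat (take k Ys′))) k≡ ⟩
    length (concat (take (length (Y ∷ I)) Ys′))        ≡⟨ cong (length ∘ concat) (take-length-++ (Y ∷ I) (Z ∷ [])) ⟩
    length (concat (Y ∷ I))                             ∎
    where
    open ≡-Reasoning
    k≡ : suc (toℕ (fromℕ m)) ≡ length (Y ∷ I)
    k≡ = trans (cong suc (toℕ-fromℕ m)) (sym |I|)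

lemma2p7 : (m n : ℕ) (hm : 1 ≤ m) → 1 ≤ n → (P Q : Word) →
    IsMDyck m n P → IsMDyck m n Q →
    (P' Q' : Word) (p q : Fin m → ℕ) →
    IsMReduction m P P' p → IsMReduction m Q Q' q →
    ((P ≤T Q) ⇔ ((P' ≤T Q') × (∀ (i : Fin m) → p i ≤ q i)))
    × (NonInitialContact P ⤖ ContactRightOf P' (p (lastIdx m hm)))
lemma2p7 (suc m) _ (s≤s z≤n) _ P Q _ _ P' Q' p q reduction-P reduction-Q =
  reduction-≤T⇔ (suc m) reduction-P reduction-Q , reduction-contacts⤖ m reduction-P
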